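{- Let $\Gamma=\langle\alpha_1,\ldots,\alpha_k\rangle\subset\mathbb N^d$ be an affine semigroup and $\gamma\in\Gamma$. For each $i\le k$ with $\gamma-\alpha_i\in\Gamma$, let $T_i\subseteq K_\gamma$ be the image, under the cover morphism $\psi_i:K_{\gamma-\alpha_i}\to K_\gamma$, of a minimum weight spanning tree of $K_{\gamma-\alpha_i}$; for $i$ with $\gamma-\alpha_i\notin\Gamma$ let $E(T_i)=\emptyset$. Let $E'$ be the set of elements $(z,w)$ of the Graver basis of $\Gamma$ with $z,w\in\mathsf Z(\gamma)$, viewed as edges of $K_\gamma$. Then the graph $G'=(\mathsf Z(\gamma),E(T_1)\cup\cdots\cup E(T_k)\cup E')$ is connected, and every minimum weight spanning tree of $G'$ is a minimum weight spanning tree of $K_\gamma$.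
   Context: An affine semigroup is a finitely generated submonoid of $\mathbb N^d$ with minimal generating set $\alpha_1,\ldots,\alpha_k$; $\varphi_\Gamma(z)=z_1\alpha_1+\cdots+z_k\alpha_k$ for $z\in\mathbb N^k$, $\mathsf Z(\gamma)=\varphi_\Gamma^{ -1}(\gamma)$, and $|z|=z_1+\cdots+z_k$. For $z,w\in\mathbb N^k$, $\gcd(z,w)=(\min(z_1,w_1),\ldots,\min(z_k,w_k))$ and $\mathrm{dist}(z,w)=\max(|z-\gcd(z,w)|,|w-\gcd(z,w)|)$. The catenary graph $K_\gamma$ is the complete graph on $\mathsf Z(\gamma)$ with each edge $\{z,w\}$ labeled $\mathrm{dist}(z,w)$; subgraphs inherit these labels. The cover morphism $\psi_i:K_{\gamma-\alpha_i}\to K_\gamma$ sends each vertex $z\in\mathsf Z(\gamma-\alpha_i)$ to $z+e_i$ ($e_i$ the $i$-th unit vector) and each edge $\{z,w\}$ to $\{z+e_i,w+e_i\}$. In an edge-labeled graph, the weight of a chain $v_0,\ldots,v_r$ (consecutive vertices adjacent) is its largest edge label; a spanning tree $T$ is of minimum weight if, for any two vertices, the unique path between them in $T$ has minimum weight among all chains in the graph joining them. The Graver basis of $\Gamma$ is the minimal generating set (Hilbert basis) of the affine semigroup $\{(z,w)\in\mathbb N^k\times\mathbb N^k:\varphi_\Gamma(z)=\varphi_\Gamma(w)\}$. -}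

module Defs where

open import Data.Nat using (ℕ; zero; suc; _+_; _*_; _∸_; _⊓_; _⊔_; _≤_)
open import Data.Fin using (Fin)
open import Data.Vec using (Vec; []; _∷_; replicate; zipWith; map; lookup; toList; _[_]≔_)
open import Data.List using (List; []; _∷_)
open import Data.Nat.ListAction using (sum)
open import Data.List.Relation.Unary.Unique.Propositional using (Unique)
open import Data.Product using (Σ; Σ-syntax; _×_; _,_)
open import Data.Sum using (_⊎_)
open import Relation.Binary.PropositionalEquality using (_≡_; _≢_)
open import Relation.Nullary using (¬_)

_+ᵥ_ : ∀ {n} → Vec ℕ n → Vec ℕ n → Vec ℕ n
_+ᵥ_ = zipWith _+_

unit : ∀ {k} → Fin k → Vec ℕ k
unit {k} i = replicate k 0 [ i ]≔ 1

∣_∣ᵥ : ∀ {n} → Vec ℕ n → ℕ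
∣ z ∣ᵥ = sum (toList z)

φ : ∀ {d k} → Vec (Vec ℕ d) k → Vec ℕ k → Vec ℕ d
φ {d} [] [] = replicate d 0
φ (a ∷ as) (z ∷ zs) = map (z *_) a +ᵥ φ as zs

InΓ : ∀ {d k} → Vec (Vec ℕ d) k → Vec ℕ d → Set
InΓ {k = k} α β = Σ[ z ∈ Vec ℕ k ] φ α z ≡ β

MinimalGens : ∀ {d k} → Vec (Vec ℕ d) k → Set
MinimalGens {k = k} α =
  ∀ (i : Fin k) → ¬ (Σ[ z ∈ Vec ℕ k ] (lookup z i ≡ 0 × φ α z ≡ lookup α i))

gcdᵥ : ∀ {n} → Vec ℕ n → Vec ℕ n → Vec ℕ n
gcdᵥ = zipWith _⊓_

dist : ∀ {n} → Vec ℕ n → Vec ℕ n → ℕ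
dist z w = ∣ zipWith _∸_ z (gcdᵥ z w) ∣ᵥ ⊔ ∣ zipWith _∸_ w (gcdᵥ z w) ∣ᵥ

-- A graph is given by a vertex
-- predicate V and an edge relation E (undirected: adjacency is the
-- symmetric closure); every edge {z,w} carries the label dist z w.

Rel : ℕ → Set₁
Rel k = Vec ℕ k → Vec ℕ k → Set

Adj : ∀ {k} → Rel k → Rel k
Adj E u v = E u v ⊎ E v u

data Chain {k} (E : Rel k) : Vec ℕ k → Vec ℕ k → List (Vec ℕ k) → Set where
  single : ∀ u → Chain E u u (u ∷ [])
  step   : ∀ {u v w vs} → Adj E u v → Chain E v w vs → Chain E u w (u ∷ vs)

weight : ∀ {k} → List (Vec ℕ k) → ℕ
weight [] = 0
weight (u ∷ []) = 0
weight (u ∷ v ∷ vs) = dist u v ⊔ weight (v ∷ vs)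

Path : ∀ {k} → Rel k → Vec ℕ k → Vec ℕ k → List (Vec ℕ k) → Set
Path E u v vs = Chain E u v vs × Unique vs

Connected : ∀ {k} → (Vec ℕ k → Set) → Rel k → Set
Connected {k} V E = ∀ (u v : Vec ℕ k) → V u → V v → Σ[ vs ∈ List (Vec ℕ k) ] Chain E u v vs

IsTree : ∀ {k} → (Vec ℕ k → Set) → Rel k → Set
IsTree {k} V T =
  (∀ (u v : Vec ℕ k) → V u → V v → Σ[ vs ∈ List (Vec ℕ k) ] Path T u v vs) ×
  (∀ (u v : Vec ℕ k) (ps qs : List (Vec ℕ k)) → Path T u v ps → Path T u v qs → ps ≡ qs)

IsSpanningTree : ∀ {k} → (Vec ℕ k → Set) → Rel k → Rel k → Set
IsSpanningTree V E T = (∀ u v → T u v → E u v) × IsTree V T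

IsMinWST : ∀ {k} → (Vec ℕ k → Set) → Rel k → Rel k → Set
IsMinWST {k} V E T =
  IsSpanningTree V E T ×
  (∀ (u v : Vec ℕ k) (ps cs : List (Vec ℕ k)) → Path T u v ps → Chain E u v cs →
     weight ps ≤ weight cs)

Z : ∀ {d k} → Vec (Vec ℕ d) k → Vec ℕ d → Vec ℕ k → Set
Z α γ z = φ α z ≡ γ

KEdge : ∀ {d k} → Vec (Vec ℕ d) k → Vec ℕ d → Rel k
KEdge α γ z w = Z α γ z × Z α γ w × z ≢ w

CoverImage : ∀ {k} → Fin k → Rel k → Rel k
CoverImage {k} i T z w =
  Σ[ z' ∈ Vec ℕ k ] Σ[ w' ∈ Vec ℕ k ] (T z' w' × z ≡ z' +ᵥ unit i × w ≡ w' +ᵥ unit i)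

-- Graver basis: minimal generating set (atoms) of the monoid
-- {(z,w) ∈ ℕ^k × ℕ^k : φ z = φ w}
InGraver : ∀ {d k} → Vec (Vec ℕ d) k → Rel k
InGraver {k = k} α z w =
  φ α z ≡ φ α w ×
  ¬ (z ≡ replicate k 0 × w ≡ replicate k 0) ×
  (∀ (z₁ w₁ z₂ w₂ : Vec ℕ k) → φ α z₁ ≡ φ α w₁ → φ α z₂ ≡ φ α w₂ →
     z₁ +ᵥ z₂ ≡ z → w₁ +ᵥ w₂ ≡ w →
     (z₁ ≡ replicate k 0 × w₁ ≡ replicate k 0) ⊎ (z₂ ≡ replicate k 0 × w₂ ≡ replicate k 0))

-- the edge set E(T_i): image of the chosen tree T' i if γ - α_i ∈ Γ, else ∅
TiEdge : ∀ {d k} → Vec (Vec ℕ d) k → Vec ℕ d → (Fin k → Rel k) → Fin k → Rel k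
TiEdge {d} α γ T' i z w =
  (Σ[ β ∈ Vec ℕ d ] (β +ᵥ lookup α i ≡ γ × InΓ α β)) × CoverImage i (T' i) z w

G'Edge : ∀ {d k} → Vec (Vec ℕ d) k → Vec ℕ d → (Fin k → Rel k) → Rel k
G'Edge {k = k} α γ T' z w =
  KEdge α γ z w × ((Σ[ i ∈ Fin k ] TiEdge α γ T' i z w) ⊎ InGraver α z w)

module Submission where

-- Write two factorizations u, v ∈ Z(γ) as u = x + z, v = x + w
-- with x = gcd(u,v), so that φ z = φ w and dist u v = |z| ⊔ |w|.  We show,
-- by well-founded induction on |z| + |w|, that x + z and x + w are joined in
-- G' by a chain of weight ≤ |z| ⊔ |w|:
--   * if x ≠ 0, say x = x' + e_i, then x' + z, x' + w ∈ Z(γ - α_i) are joined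
--     by a path of weight ≤ dist z w in the minimum weight spanning tree of
--     K_{γ-α_i}, and the cover morphism ψ_i carries it into E(T_i);
--   * if x = 0 and (z,w) is a Graver element, {z,w} is itself an edge of E';
--   * otherwise (z,w) = (z₁,w₁) + (z₂,w₂) with both summands nonzero kernel
--     pairs, and z₁ + z₂ → w₁ + z₂ → w₁ + w₂ are two strictly smaller steps.
-- Hence every edge of K_γ is bridged in G' by a chain of no larger weight;
-- this gives connectivity, and a general transfer lemma for minimum weight
-- spanning trees along such bridged subgraphs gives the second claim.

open import Defs
open import Algebra.Bundles using (CommutativeMonoid)
import Algebra.Properties.CommutativeSemigroup as CommutativeSemigroupProperties
open import Data.Empty using (⊥-elim)
open import Data.Fin using (Fin; zero; suc)
open import Data.List using (List; []; _∷_)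
import Data.List as List
open import Data.Nat using (ℕ; zero; suc; _+_; _*_; _∸_; _⊓_; _⊔_; _≤_; _<_; _≟_; z≤n; s≤s)
open import Data.Nat.Induction using (<-wellFounded)
open import Data.Nat.Properties
open import Data.Product using (Σ-syntax; _×_; _,_; proj₁)
open import Data.Sum using (_⊎_; inj₁; inj₂)
import Data.Sum as Sum
open import Data.Vec using (Vec; []; _∷_; replicate; zipWith; map; lookup)
open import Data.Vec.Properties using (∷-injective; map-const; ≡-dec)
open import Data.Vec.Relation.Binary.Pointwise.Inductive
  using (Pointwise-≡⇒≡; zipWith-assoc; zipWith-comm; zipWith-identityˡ; zipWith-identityʳ)
open import Induction.WellFounded using (Acc; acc)
open import Relation.Nullary using (¬_; Dec; yes; no)
open import Relation.Nullary.Decidable using (map′; _×-dec_; ¬?)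
open import Relation.Binary.PropositionalEquality
open import Relation.Binary.PropositionalEquality.Algebra using (isMagma)

open CommutativeSemigroupProperties +-commutativeSemigroup
  using () renaming (interchange to +-interchange)

0ᵥ : ∀ {n} → Vec ℕ n
0ᵥ {n} = replicate n 0

_≟ᵥ_ : ∀ {n} (u v : Vec ℕ n) → Dec (u ≡ v)
_≟ᵥ_ = ≡-dec _≟_

+ᵥ-commutativeMonoid : ℕ → CommutativeMonoid _ _
+ᵥ-commutativeMonoid n = record
  { Carrier = Vec ℕ n
  ; _≈_ = _≡_
  ; _∙_ = _+ᵥ_
  ; ε = 0ᵥ
  ; isCommutativeMonoid = record
    { isMonoid = record
      { isSemigroup = record
        { isMagma = isMagma _+ᵥ_
        ; assoc = λ u v w → Pointwise-≡⇒≡ (zipWith-assoc +-assoc u v w)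
        }
      ; identity = (λ u → Pointwise-≡⇒≡ (zipWith-identityˡ +-identityˡ u))
                 , (λ u → Pointwise-≡⇒≡ (zipWith-identityʳ +-identityʳ u))
      }
    ; comm = λ u v → Pointwise-≡⇒≡ (zipWith-comm +-comm u v)
    }
  }

open module +ᵥ-Laws {n} = CommutativeMonoid (+ᵥ-commutativeMonoid n)
  using () renaming (assoc to +ᵥ-assoc; comm to +ᵥ-comm;
                     identityˡ to +ᵥ-identityˡ; identityʳ to +ᵥ-identityʳ)
open module +ᵥ-Rearrangements {n} = CommutativeSemigroupProperties
  (CommutativeMonoid.commutativeSemigroup (+ᵥ-commutativeMonoid n))
  using () renaming (interchange to +ᵥ-interchange; xy∙z≈xz∙y to +ᵥ-swapʳ)

+ᵥ-cancelˡ : ∀ {n} (x u v : Vec ℕ n) → x +ᵥ u ≡ x +ᵥ v → u ≡ v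
+ᵥ-cancelˡ [] [] [] _ = refl
+ᵥ-cancelˡ (a ∷ x) (b ∷ u) (c ∷ v) eq with ∷-injective eq
... | heads , tails = cong₂ _∷_ (+-cancelˡ-≡ a b c heads) (+ᵥ-cancelˡ x u v tails)

+ᵥ-cancelʳ : ∀ {n} (x u v : Vec ℕ n) → u +ᵥ x ≡ v +ᵥ x → u ≡ v
+ᵥ-cancelʳ x u v eq = +ᵥ-cancelˡ x u v (trans (+ᵥ-comm x u) (trans eq (+ᵥ-comm v x)))

zero-or-cover : ∀ {k} (x : Vec ℕ k) → x ≡ 0ᵥ ⊎ Σ[ x' ∈ Vec ℕ k ] Σ[ i ∈ Fin k ] x ≡ x' +ᵥ unit i
zero-or-cover [] = inj₁ refl
zero-or-cover (suc a ∷ x) = inj₂ (a ∷ x , zero , cong₂ _∷_ (+-comm 1 a) (sym (+ᵥ-identityʳ x)))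
zero-or-cover (zero ∷ x) with zero-or-cover x
... | inj₁ x≡0 = inj₁ (cong (0 ∷_) x≡0)
... | inj₂ (x' , i , x≡x'+eᵢ) = inj₂ (0 ∷ x' , suc i , cong (0 ∷_) x≡x'+eᵢ)

scale-+ : ∀ {d} (m n : ℕ) (a : Vec ℕ d) → map ((m + n) *_) a ≡ map (m *_) a +ᵥ map (n *_) a
scale-+ m n [] = refl
scale-+ m n (x ∷ a) = cong₂ _∷_ (*-distribʳ-+ x m n) (scale-+ m n a)

scale-1 : ∀ {d} (a : Vec ℕ d) → map (1 *_) a ≡ a
scale-1 [] = refl
scale-1 (x ∷ a) = cong₂ _∷_ (*-identityˡ x) (scale-1 a)

φ-+ : ∀ {d k} (α : Vec (Vec ℕ d) k) (z w : Vec ℕ k) → φ α (z +ᵥ w) ≡ φ α z +ᵥ φ α w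
φ-+ [] [] [] = sym (+ᵥ-identityˡ 0ᵥ)
φ-+ (a ∷ α) (m ∷ z) (n ∷ w) = begin
  map ((m + n) *_) a +ᵥ φ α (z +ᵥ w)
    ≡⟨ cong₂ _+ᵥ_ (scale-+ m n a) (φ-+ α z w) ⟩
  (map (m *_) a +ᵥ map (n *_) a) +ᵥ (φ α z +ᵥ φ α w)
    ≡⟨ +ᵥ-interchange (map (m *_) a) (map (n *_) a) (φ α z) (φ α w) ⟩
  (map (m *_) a +ᵥ φ α z) +ᵥ (map (n *_) a +ᵥ φ α w) ∎
  where open ≡-Reasoning

φ-0 : ∀ {d k} (α : Vec (Vec ℕ d) k) → φ α 0ᵥ ≡ 0ᵥ
φ-0 [] = refl
φ-0 (a ∷ α) = trans (cong₂ _+ᵥ_ (map-const a 0) (φ-0 α)) (+ᵥ-identityˡ 0ᵥ)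

φ-unit : ∀ {d k} (α : Vec (Vec ℕ d) k) (i : Fin k) → φ α (unit i) ≡ lookup α i
φ-unit (a ∷ α) zero = trans (cong₂ _+ᵥ_ (scale-1 a) (φ-0 α)) (+ᵥ-identityʳ a)
φ-unit (a ∷ α) (suc i) = trans (cong₂ _+ᵥ_ (map-const a 0) (φ-unit α i)) (+ᵥ-identityˡ _)

∣+∣ : ∀ {n} (u v : Vec ℕ n) → ∣ u +ᵥ v ∣ᵥ ≡ ∣ u ∣ᵥ + ∣ v ∣ᵥ
∣+∣ [] [] = refl
∣+∣ (x ∷ u) (y ∷ v) = trans (cong (x + y +_) (∣+∣ u v)) (+-interchange x y ∣ u ∣ᵥ ∣ v ∣ᵥ)

∣∣-monoˡ : ∀ {n} (u v : Vec ℕ n) → ∣ u ∣ᵥ ≤ ∣ u +ᵥ v ∣ᵥ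
∣∣-monoˡ u v = ≤-trans (m≤m+n ∣ u ∣ᵥ ∣ v ∣ᵥ) (≤-reflexive (sym (∣+∣ u v)))

∣∣-monoʳ : ∀ {n} (u v : Vec ℕ n) → ∣ v ∣ᵥ ≤ ∣ u +ᵥ v ∣ᵥ
∣∣-monoʳ u v = ≤-trans (m≤n+m ∣ v ∣ᵥ ∣ u ∣ᵥ) (≤-reflexive (sym (∣+∣ u v)))

∣∣≡0⇒≡0 : ∀ {n} (v : Vec ℕ n) → ∣ v ∣ᵥ ≡ 0 → v ≡ 0ᵥ
∣∣≡0⇒≡0 [] _ = refl
∣∣≡0⇒≡0 (x ∷ v) eq = cong₂ _∷_ (m+n≡0⇒m≡0 x eq) (∣∣≡0⇒≡0 v (m+n≡0⇒n≡0 x eq))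

pair-size-pos : ∀ {n} (z w : Vec ℕ n) → ¬ (z ≡ 0ᵥ × w ≡ 0ᵥ) → 0 < ∣ z ∣ᵥ + ∣ w ∣ᵥ
pair-size-pos z w nonzero = n≢0⇒n>0 λ eq →
  nonzero (∣∣≡0⇒≡0 z (m+n≡0⇒m≡0 ∣ z ∣ᵥ eq) , ∣∣≡0⇒≡0 w (m+n≡0⇒n≡0 ∣ z ∣ᵥ eq))

∣∸∣≤ : ∀ {n} (z g : Vec ℕ n) → ∣ zipWith _∸_ z g ∣ᵥ ≤ ∣ z ∣ᵥ
∣∸∣≤ [] [] = z≤n
∣∸∣≤ (a ∷ z) (b ∷ g) = +-mono-≤ (m∸n≤m a b) (∣∸∣≤ z g)

excess : ∀ {n} → Vec ℕ n → Vec ℕ n → Vec ℕ n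
excess z w = zipWith _∸_ z (gcdᵥ z w)

gcdᵥ-comm : ∀ {n} (z w : Vec ℕ n) → gcdᵥ z w ≡ gcdᵥ w z
gcdᵥ-comm z w = Pointwise-≡⇒≡ (zipWith-comm ⊓-comm z w)

gcd+excess : ∀ {n} (z w : Vec ℕ n) → gcdᵥ z w +ᵥ excess z w ≡ z
gcd+excess [] [] = refl
gcd+excess (a ∷ z) (b ∷ w) = cong₂ _∷_ (m+[n∸m]≡n (m⊓n≤m a b)) (gcd+excess z w)

gcd+excessʳ : ∀ {n} (z w : Vec ℕ n) → gcdᵥ z w +ᵥ excess w z ≡ w
gcd+excessʳ z w = trans (cong (_+ᵥ excess w z) (gcdᵥ-comm z w)) (gcd+excess w z)

dist-excess : ∀ {n} (z w : Vec ℕ n) → dist z w ≡ ∣ excess z w ∣ᵥ ⊔ ∣ excess w z ∣ᵥ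
dist-excess z w = cong (λ g → ∣ excess z w ∣ᵥ ⊔ ∣ zipWith _∸_ w g ∣ᵥ) (gcdᵥ-comm z w)

excess-shift : ∀ {n} (x z w : Vec ℕ n) → excess (x +ᵥ z) (x +ᵥ w) ≡ excess z w
excess-shift [] [] [] = refl
excess-shift (a ∷ x) (b ∷ z) (c ∷ w) = cong₂ _∷_
  (trans (cong (a + b ∸_) (sym (+-distribˡ-⊓ a b c))) ([m+n]∸[m+o]≡n∸o a b (b ⊓ c)))
  (excess-shift x z w)

-- distance is translation invariant: the cover morphisms preserve labels
dist-shift : ∀ {n} (x z w : Vec ℕ n) → dist (x +ᵥ z) (x +ᵥ w) ≡ dist z w
dist-shift x z w = begin
  dist (x +ᵥ z) (x +ᵥ w)
    ≡⟨ dist-excess (x +ᵥ z) (x +ᵥ w) ⟩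
  ∣ excess (x +ᵥ z) (x +ᵥ w) ∣ᵥ ⊔ ∣ excess (x +ᵥ w) (x +ᵥ z) ∣ᵥ
    ≡⟨ cong₂ (λ p q → ∣ p ∣ᵥ ⊔ ∣ q ∣ᵥ) (excess-shift x z w) (excess-shift x w z) ⟩
  ∣ excess z w ∣ᵥ ⊔ ∣ excess w z ∣ᵥ
    ≡⟨ sym (dist-excess z w) ⟩
  dist z w ∎
  where open ≡-Reasoning

dist-shiftʳ : ∀ {n} (x z w : Vec ℕ n) → dist (z +ᵥ x) (w +ᵥ x) ≡ dist z w
dist-shiftʳ x z w = trans (cong₂ dist (+ᵥ-comm z x) (+ᵥ-comm w x)) (dist-shift x z w)

dist≤size : ∀ {n} (z w : Vec ℕ n) → dist z w ≤ ∣ z ∣ᵥ ⊔ ∣ w ∣ᵥ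
dist≤size z w = ⊔-mono-≤ (∣∸∣≤ z (gcdᵥ z w)) (∣∸∣≤ w (gcdᵥ z w))

Decomposition : ∀ {n} → (Vec ℕ n → Vec ℕ n → Set) → Vec ℕ n → Set
Decomposition {n} P z = Σ[ a ∈ Vec ℕ n ] Σ[ b ∈ Vec ℕ n ] (a +ᵥ b ≡ z × P a b)

-- A vector has finitely many decompositions, so searching them is decidable:
-- the first coordinate c splits as h + (c ∸ h) with h < 1 + c.
decomposition? : ∀ {n} (P : Vec ℕ n → Vec ℕ n → Set) → (∀ a b → Dec (P a b)) →
  ∀ z → Dec (Decomposition P z)
decomposition? P P? [] = map′ (λ p → [] , [] , refl , p) (λ { ([] , [] , _ , p) → p }) (P? [] [])
decomposition? P P? (c ∷ z) = map′ glue split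
  (anyUpTo? (λ h → decomposition? (λ a b → P (h ∷ a) ((c ∸ h) ∷ b))
                                  (λ a b → P? (h ∷ a) ((c ∸ h) ∷ b)) z) (suc c))
  where
  glue : Σ[ h ∈ ℕ ] (h < suc c × Decomposition (λ a b → P (h ∷ a) ((c ∸ h) ∷ b)) z) →
         Decomposition P (c ∷ z)
  glue (h , h<1+c , a , b , a+b≡z , p) =
    h ∷ a , (c ∸ h) ∷ b , cong₂ _∷_ (m+[n∸m]≡n (≤-pred h<1+c)) a+b≡z , p
  split : Decomposition P (c ∷ z) →
          Σ[ h ∈ ℕ ] (h < suc c × Decomposition (λ a b → P (h ∷ a) ((c ∸ h) ∷ b)) z)
  split (h ∷ a , h' ∷ b , eq , p) with ∷-injective eq
  ... | h+h'≡c , a+b≡z =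
    h , s≤s (≤-trans (m≤m+n h h') (≤-reflexive h+h'≡c)) , a , b , a+b≡z ,
    subst (λ t → P (h ∷ a) (t ∷ b)) (sym c∸h≡h') p
    where
    c∸h≡h' : c ∸ h ≡ h'
    c∸h≡h' = trans (cong (_∸ h) (sym h+h'≡c)) (m+n∸m≡n h h')

module _ {d k : ℕ} (α : Vec (Vec ℕ d) k) where

  NonzeroKernelPair : Vec ℕ k → Vec ℕ k → Set
  NonzeroKernelPair z w = φ α z ≡ φ α w × ¬ (z ≡ 0ᵥ × w ≡ 0ᵥ)

  nonzeroKernelPair? : ∀ z w → Dec (NonzeroKernelPair z w)
  nonzeroKernelPair? z w = (φ α z ≟ᵥ φ α w) ×-dec ¬? ((z ≟ᵥ 0ᵥ) ×-dec (w ≟ᵥ 0ᵥ))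

  Splitting : Vec ℕ k → Vec ℕ k → Set
  Splitting z w = Decomposition (λ z₁ z₂ → Decomposition (λ w₁ w₂ →
    NonzeroKernelPair z₁ w₁ × NonzeroKernelPair z₂ w₂) w) z

  splitting? : ∀ z w → Dec (Splitting z w)
  splitting? z w = decomposition? _ (λ z₁ z₂ → decomposition? _ (λ w₁ w₂ →
    nonzeroKernelPair? z₁ w₁ ×-dec nonzeroKernelPair? z₂ w₂) w) z

  graver-or-splitting : ∀ {z w} → NonzeroKernelPair z w → InGraver α z w ⊎ Splitting z w
  graver-or-splitting {z} {w} (φz≡φw , nonzero) with splitting? z w
  ... | yes s = inj₂ s
  ... | no ¬s = inj₁ (φz≡φw , nonzero , indecomposable)
    where
    indecomposable : ∀ z₁ w₁ z₂ w₂ → φ α z₁ ≡ φ α w₁ → φ α z₂ ≡ φ α w₂ →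
      z₁ +ᵥ z₂ ≡ z → w₁ +ᵥ w₂ ≡ w → (z₁ ≡ 0ᵥ × w₁ ≡ 0ᵥ) ⊎ (z₂ ≡ 0ᵥ × w₂ ≡ 0ᵥ)
    indecomposable z₁ w₁ z₂ w₂ rel₁ rel₂ sumz sumw
      with (z₁ ≟ᵥ 0ᵥ) ×-dec (w₁ ≟ᵥ 0ᵥ) | (z₂ ≟ᵥ 0ᵥ) ×-dec (w₂ ≟ᵥ 0ᵥ)
    ... | yes zero₁ | _ = inj₁ zero₁
    ... | no _ | yes zero₂ = inj₂ zero₂
    ... | no nonzero₁ | no nonzero₂ =
      ⊥-elim (¬s (z₁ , z₂ , sumz , w₁ , w₂ , sumw , (rel₁ , nonzero₁) , (rel₂ , nonzero₂)))

Reach : ∀ {k} → Rel k → ℕ → Vec ℕ k → Vec ℕ k → Set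
Reach {k} E b u v = Σ[ ps ∈ List (Vec ℕ k) ] (Chain E u v ps × weight ps ≤ b)

module _ {k : ℕ} {E : Rel k} where

  weight-cons : ∀ {u v w qs} → Chain E v w qs → weight (u ∷ qs) ≡ dist u v ⊔ weight qs
  weight-cons (single _) = refl
  weight-cons (step _ _) = refl

  reach-refl : ∀ {b u} → Reach E b u u
  reach-refl {u = u} = u ∷ [] , single u , z≤n

  reach-edge : ∀ {u v} → E u v → Reach E (dist u v) u v
  reach-edge {u} {v} e = u ∷ v ∷ [] , step (inj₁ e) (single v) , ≤-reflexive (⊔-identityʳ (dist u v))

  reach-mono : ∀ {b b' u v} → b ≤ b' → Reach E b u v → Reach E b' u v
  reach-mono b≤b' (ps , chain , wt) = ps , chain , ≤-trans wt b≤b'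

  weight-cons-≤⁻ : ∀ {b u v w qs} → Chain E v w qs → weight (u ∷ qs) ≤ b →
    dist u v ≤ b × weight qs ≤ b
  weight-cons-≤⁻ {u = u} {v} {qs = qs} chain wt =
    m⊔n≤o⇒m≤o (dist u v) (weight qs) wt′ , m⊔n≤o⇒n≤o (dist u v) (weight qs) wt′
    where wt′ = ≤-trans (≤-reflexive (sym (weight-cons chain))) wt

  weight-cons-≤⁺ : ∀ {b u v w qs} → Chain E v w qs → dist u v ≤ b → weight qs ≤ b →
    weight (u ∷ qs) ≤ b
  weight-cons-≤⁺ chain head≤b tail≤b = ≤-trans (≤-reflexive (weight-cons chain)) (⊔-lub head≤b tail≤b)

  chain-reach-trans : ∀ {b u v w ps} → Chain E u v ps → weight ps ≤ b → Reach E b v w → Reach E b u w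
  chain-reach-trans (single _) _ r = r
  chain-reach-trans (step {u = u} adj chain) wt r =
    let head≤b , tail≤b = weight-cons-≤⁻ chain wt
        qs , chain′ , wt′ = chain-reach-trans chain tail≤b r
    in u ∷ qs , step adj chain′ , weight-cons-≤⁺ chain′ head≤b wt′

  reach-trans : ∀ {b u v w} → Reach E b u v → Reach E b v w → Reach E b u w
  reach-trans (ps , chain , wt) = chain-reach-trans chain wt

module _ {k : ℕ} {E F : Rel k} (f : Vec ℕ k → Vec ℕ k)
         (f-edge : ∀ {u v} → E u v → F (f u) (f v))
         (f-dist : ∀ u v → dist (f u) (f v) ≡ dist u v) where

  chain-map : ∀ {u v ps} → Chain E u v ps → Chain F (f u) (f v) (List.map f ps)
  chain-map (single u) = single (f u)
  chain-map (step adj chain) = step (Sum.map f-edge f-edge adj) (chain-map chain)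

  weight-map : ∀ ps → weight (List.map f ps) ≡ weight ps
  weight-map [] = refl
  weight-map (u ∷ []) = refl
  weight-map (u ∷ v ∷ ps) = cong₂ _⊔_ (f-dist u v) (weight-map (v ∷ ps))

  reach-map : ∀ {b u v} → Reach E b u v → Reach F b (f u) (f v)
  reach-map (ps , chain , wt) =
    List.map f ps , chain-map chain , ≤-trans (≤-reflexive (weight-map ps)) wt

module _ {k : ℕ} {E F : Rel k} (bridge : ∀ {u v} → Adj E u v → Reach F (dist u v) u v) where

  reach-refine : ∀ {u v cs} → Chain E u v cs → Reach F (weight cs) u v
  reach-refine (single u) = reach-refl
  reach-refine (step {u = u} {v = v} adj chain) =
    subst (λ b → Reach F b u _) (sym (weight-cons chain))
      (reach-trans (reach-mono (m≤m⊔n (dist u v) _) (bridge adj))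
                   (reach-mono (m≤n⊔m (dist u v) _) (reach-refine chain)))

module _ {k : ℕ} {V : Vec ℕ k → Set} {E T : Rel k} (min : IsMinWST V E T) where

  minWST-reach : ∀ {b u v} → V u → V v → Reach E b u v → Reach T b u v
  minWST-reach {u = u} {v} Vu Vv (cs , chain , wt) =
    let ((_ , paths , _) , minimal) = min
        ps , path = paths u v Vu Vv
    in ps , proj₁ path , ≤-trans (minimal u v ps cs path chain) wt

minWST-transfer : ∀ {k} {V : Vec ℕ k → Set} {E F T : Rel k} →
  (∀ u v → F u v → E u v) → (∀ {u v} → Adj E u v → Reach F (dist u v) u v) →
  IsMinWST V F T → IsMinWST V E T
minWST-transfer F⊆E bridge ((T⊆F , tree) , minimal) =
  ((λ u v t → F⊆E u v (T⊆F u v t)) , tree) ,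
  λ u v ps cs path chain →
    let qs , chain′ , wt = reach-refine bridge chain
    in ≤-trans (minimal u v ps qs path chain′) wt

module Bridges {d k : ℕ} (α : Vec (Vec ℕ d) k) (γ : Vec ℕ d) (T' : Fin k → Rel k)
  (T'-min : ∀ (i : Fin k) (β : Vec ℕ d) → β +ᵥ lookup α i ≡ γ → InΓ α β →
            IsMinWST (Z α β) (KEdge α β) (T' i)) where

  G' : Rel k
  G' = G'Edge α γ T'

  ψ-edge : ∀ i {β} (β+αᵢ≡γ : β +ᵥ lookup α i ≡ γ) (β∈Γ : InΓ α β) →
    ∀ {a b} → T' i a b → G' (a +ᵥ unit i) (b +ᵥ unit i)
  ψ-edge i {β} β+αᵢ≡γ β∈Γ {a} {b} t with proj₁ (proj₁ (T'-min i β β+αᵢ≡γ β∈Γ)) a b t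
  ... | a∈Zβ , b∈Zβ , a≢b =
    (lifted a∈Zβ , lifted b∈Zβ , λ eq → a≢b (+ᵥ-cancelʳ (unit i) a b eq)) ,
    inj₁ (i , (β , β+αᵢ≡γ , β∈Γ) , a , b , t , refl , refl)
    where
    lifted : ∀ {c} → Z α β c → Z α γ (c +ᵥ unit i)
    lifted {c} c∈Zβ = trans (φ-+ α c (unit i)) (trans (cong₂ _+ᵥ_ c∈Zβ (φ-unit α i)) β+αᵢ≡γ)

  cover-bridge : ∀ i {β} → β +ᵥ lookup α i ≡ γ → InΓ α β →
    ∀ {u v} → Z α β u → Z α β v → Reach G' (dist u v) (u +ᵥ unit i) (v +ᵥ unit i)
  cover-bridge i {β} β+αᵢ≡γ β∈Γ {u} {v} u∈Zβ v∈Zβ with u ≟ᵥ v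
  ... | yes refl = reach-refl
  ... | no u≢v = reach-map (_+ᵥ unit i) (ψ-edge i β+αᵢ≡γ β∈Γ) (dist-shiftʳ (unit i))
    (minWST-reach (T'-min i β β+αᵢ≡γ β∈Γ) u∈Zβ v∈Zβ (reach-edge (u∈Zβ , v∈Zβ , u≢v)))

  Bridged : Vec ℕ k → Vec ℕ k → Vec ℕ k → Set
  Bridged x z w = Reach G' (∣ z ∣ᵥ ⊔ ∣ w ∣ᵥ) (x +ᵥ z) (x +ᵥ w)

  -- Case x = x' + e_i: work in K_{γ-α_i} with β = φ(x' + z).
  bridged-by-cover : ∀ x' i z w → φ α ((x' +ᵥ unit i) +ᵥ z) ≡ γ → φ α z ≡ φ α w →
    Bridged (x' +ᵥ unit i) z w
  bridged-by-cover x' i z w x+z∈Zγ φz≡φw =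
    subst₂ (Reach G' (∣ z ∣ᵥ ⊔ ∣ w ∣ᵥ)) (sym (+ᵥ-swapʳ x' (unit i) z)) (sym (+ᵥ-swapʳ x' (unit i) w))
      (reach-mono (≤-trans (≤-reflexive (dist-shift x' z w)) (dist≤size z w))
        (cover-bridge i β+αᵢ≡γ (x' +ᵥ z , refl) refl x'+w∈Zβ))
    where
    β = φ α (x' +ᵥ z)
    β+αᵢ≡γ : β +ᵥ lookup α i ≡ γ
    β+αᵢ≡γ = begin
      β +ᵥ lookup α i                ≡⟨ cong (β +ᵥ_) (sym (φ-unit α i)) ⟩
      β +ᵥ φ α (unit i)              ≡⟨ sym (φ-+ α (x' +ᵥ z) (unit i)) ⟩
      φ α ((x' +ᵥ z) +ᵥ unit i)      ≡⟨ cong (φ α) (sym (+ᵥ-swapʳ x' (unit i) z)) ⟩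
      φ α ((x' +ᵥ unit i) +ᵥ z)      ≡⟨ x+z∈Zγ ⟩
      γ                              ∎
      where open ≡-Reasoning
    x'+w∈Zβ : φ α (x' +ᵥ w) ≡ β
    x'+w∈Zβ = trans (φ-+ α x' w) (trans (cong (φ α x' +ᵥ_) (sym φz≡φw)) (sym (φ-+ α x' z)))

  -- Case (z, w) = (z₁ + z₂, w₁ + w₂): pass through x + w₁ + z₂, using the
  -- bridging property for the two strictly smaller kernel pairs.
  bridged-by-splitting : ∀ x z₁ z₂ w₁ w₂ → φ α (x +ᵥ (z₁ +ᵥ z₂)) ≡ γ →
    NonzeroKernelPair α z₁ w₁ → NonzeroKernelPair α z₂ w₂ →
    (∀ y z w → φ α (y +ᵥ z) ≡ γ → φ α z ≡ φ α w →
       ∣ z ∣ᵥ + ∣ w ∣ᵥ < ∣ z₁ +ᵥ z₂ ∣ᵥ + ∣ w₁ +ᵥ w₂ ∣ᵥ → Bridged y z w) →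
    Bridged x (z₁ +ᵥ z₂) (w₁ +ᵥ w₂)
  bridged-by-splitting x z₁ z₂ w₁ w₂ x+z∈Zγ (φz₁≡φw₁ , nonzero₁) (φz₂≡φw₂ , nonzero₂) smaller =
    reach-trans
      (subst₂ (Reach G' bound) start middle
        (reach-mono (⊔-mono-≤ (∣∣-monoˡ z₁ z₂) (∣∣-monoˡ w₁ w₂))
          (smaller (x +ᵥ z₂) z₁ w₁ (trans (cong (φ α) start) x+z∈Zγ) φz₁≡φw₁ first-smaller)))
      (subst (Reach G' bound ((x +ᵥ w₁) +ᵥ z₂)) (+ᵥ-assoc x w₁ w₂)
        (reach-mono (⊔-mono-≤ (∣∣-monoʳ z₁ z₂) (∣∣-monoʳ w₁ w₂))
          (smaller (x +ᵥ w₁) z₂ w₂ middle∈Zγ φz₂≡φw₂ second-smaller)))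
    where
    bound = ∣ z₁ +ᵥ z₂ ∣ᵥ ⊔ ∣ w₁ +ᵥ w₂ ∣ᵥ
    start : (x +ᵥ z₂) +ᵥ z₁ ≡ x +ᵥ (z₁ +ᵥ z₂)
    start = trans (+ᵥ-assoc x z₂ z₁) (cong (x +ᵥ_) (+ᵥ-comm z₂ z₁))
    middle : (x +ᵥ z₂) +ᵥ w₁ ≡ (x +ᵥ w₁) +ᵥ z₂
    middle = +ᵥ-swapʳ x z₂ w₁
    middle∈Zγ : φ α ((x +ᵥ w₁) +ᵥ z₂) ≡ γ
    middle∈Zγ = begin
      φ α ((x +ᵥ w₁) +ᵥ z₂)          ≡⟨ cong (φ α) (sym middle) ⟩
      φ α ((x +ᵥ z₂) +ᵥ w₁)          ≡⟨ φ-+ α (x +ᵥ z₂) w₁ ⟩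
      φ α (x +ᵥ z₂) +ᵥ φ α w₁        ≡⟨ cong (φ α (x +ᵥ z₂) +ᵥ_) (sym φz₁≡φw₁) ⟩
      φ α (x +ᵥ z₂) +ᵥ φ α z₁        ≡⟨ sym (φ-+ α (x +ᵥ z₂) z₁) ⟩
      φ α ((x +ᵥ z₂) +ᵥ z₁)          ≡⟨ cong (φ α) start ⟩
      φ α (x +ᵥ (z₁ +ᵥ z₂))          ≡⟨ x+z∈Zγ ⟩
      γ                              ∎
      where open ≡-Reasoning
    total : ∣ z₁ +ᵥ z₂ ∣ᵥ + ∣ w₁ +ᵥ w₂ ∣ᵥ ≡ (∣ z₁ ∣ᵥ + ∣ w₁ ∣ᵥ) + (∣ z₂ ∣ᵥ + ∣ w₂ ∣ᵥ)
    total = trans (cong₂ _+_ (∣+∣ z₁ z₂) (∣+∣ w₁ w₂)) (+-interchange ∣ z₁ ∣ᵥ ∣ z₂ ∣ᵥ ∣ w₁ ∣ᵥ ∣ w₂ ∣ᵥ)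
    first-smaller : ∣ z₁ ∣ᵥ + ∣ w₁ ∣ᵥ < ∣ z₁ +ᵥ z₂ ∣ᵥ + ∣ w₁ +ᵥ w₂ ∣ᵥ
    first-smaller = ≤-trans (m<m+n _ (pair-size-pos z₂ w₂ nonzero₂)) (≤-reflexive (sym total))
    second-smaller : ∣ z₂ ∣ᵥ + ∣ w₂ ∣ᵥ < ∣ z₁ +ᵥ z₂ ∣ᵥ + ∣ w₁ +ᵥ w₂ ∣ᵥ
    second-smaller = ≤-trans (m<n+m _ (pair-size-pos z₁ w₁ nonzero₁)) (≤-reflexive (sym total))

  bridged : ∀ x z w → φ α (x +ᵥ z) ≡ γ → φ α z ≡ φ α w →
    Acc _<_ (∣ z ∣ᵥ + ∣ w ∣ᵥ) → Bridged x z w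
  bridged x z w x+z∈Zγ φz≡φw (acc smaller) with z ≟ᵥ w | zero-or-cover x
  ... | yes refl | _ = reach-refl
  ... | no _ | inj₂ (x' , i , refl) = bridged-by-cover x' i z w x+z∈Zγ φz≡φw
  ... | no z≢w | inj₁ refl
    with graver-or-splitting α (φz≡φw , λ (z≡0 , w≡0) → z≢w (trans z≡0 (sym w≡0)))
  ...   | inj₁ graver =
    subst₂ (Reach G' _) (sym (+ᵥ-identityˡ z)) (sym (+ᵥ-identityˡ w))
      (reach-mono (dist≤size z w) (reach-edge ((z∈Zγ , trans (sym φz≡φw) z∈Zγ , z≢w) , inj₂ graver)))
    where z∈Zγ = trans (cong (φ α) (sym (+ᵥ-identityˡ z))) x+z∈Zγ
  ...   | inj₂ (z₁ , z₂ , refl , w₁ , w₂ , refl , pair₁ , pair₂) =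
    bridged-by-splitting 0ᵥ z₁ z₂ w₁ w₂ x+z∈Zγ pair₁ pair₂
      λ y z' w' y+z'∈Zγ φz'≡φw' lt → bridged y z' w' y+z'∈Zγ φz'≡φw' (smaller lt)

  -- Any two factorizations of γ are joined in G' within their distance:
  -- apply the induction to u = g + excess u v, v = g + excess v u.
  bridge : ∀ {u v} → Z α γ u → Z α γ v → Reach G' (dist u v) u v
  bridge {u} {v} u∈Zγ v∈Zγ =
    subst₂ (Reach G' (dist u v)) (gcd+excess u v) (gcd+excessʳ u v)
      (subst (λ b → Reach G' b (g +ᵥ excess u v) (g +ᵥ excess v u)) (sym (dist-excess u v))
        (bridged g (excess u v) (excess v u) g+z∈Zγ kernel (<-wellFounded _)))
    where
    g = gcdᵥ u v
    g+z∈Zγ : φ α (g +ᵥ excess u v) ≡ γ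
    g+z∈Zγ = trans (cong (φ α) (gcd+excess u v)) u∈Zγ
    g+w∈Zγ : φ α (g +ᵥ excess v u) ≡ γ
    g+w∈Zγ = trans (cong (φ α) (gcd+excessʳ u v)) v∈Zγ
    kernel : φ α (excess u v) ≡ φ α (excess v u)
    kernel = +ᵥ-cancelˡ (φ α g) _ _
      (trans (sym (φ-+ α g (excess u v))) (trans g+z∈Zγ (trans (sym g+w∈Zγ) (φ-+ α g (excess v u)))))

  edge-bridge : ∀ {u v} → Adj (KEdge α γ) u v → Reach G' (dist u v) u v
  edge-bridge (inj₁ (u∈Zγ , v∈Zγ , _)) = bridge u∈Zγ v∈Zγ
  edge-bridge (inj₂ (v∈Zγ , u∈Zγ , _)) = bridge u∈Zγ v∈Zγ

theorem4p10 : ∀ {d k : ℕ} (α : Vec (Vec ℕ d) k) → MinimalGens α →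
    (γ : Vec ℕ d) → InΓ α γ →
    (T' : Fin k → Rel k) →
    (∀ (i : Fin k) (β : Vec ℕ d) → β +ᵥ lookup α i ≡ γ → InΓ α β →
       IsMinWST (Z α β) (KEdge α β) (T' i)) →
    Connected (Z α γ) (G'Edge α γ T') ×
    (∀ (T : Rel k) → IsMinWST (Z α γ) (G'Edge α γ T') T → IsMinWST (Z α γ) (KEdge α γ) T)
theorem4p10 α _ γ _ T' T'-min =
  (λ u v u∈Zγ v∈Zγ → let ps , chain , _ = bridge u∈Zγ v∈Zγ in ps , chain) ,
  (λ T → minWST-transfer (λ _ _ → proj₁) edge-bridge)
  where open Bridges α γ T' T'-min
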